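{- For all CSP processes $P,Q$: if $P\Rightarrow Q$ then $P\sqsubseteq_{CS}^\Delta Q$ (that is, $Q\sqsupseteq_{CS}^\Delta P$).
   Context: Fix a set $\Sigma$ of communications and an internal action $\tau\notin\Sigma$; $a$ ranges over $\Sigma$ and $\alpha$ over $\Sigma\cup\{\tau\}$. CSP expressions are generated by $P,Q ::= \mathrm{STOP}\mid \mathrm{div}\mid a\to P\mid P\sqcap Q\mid P\,\Box\,Q\mid P\rhd Q\mid P\,\|_A\,Q\mid P\setminus A\mid f(P)\mid P\,\triangle\,Q\mid P\,\Theta_A\,Q\mid X\mid \mu X.P$, with $A\subseteq\Sigma$, $f:\Sigma\to\Sigma$ (extended by $f(\tau)=\tau$), $X$ a process identifier. A CSP process is an expression in which every occurrence of an identifier $X$ lies within a subexpression $\mu X.P$. Transitions $P\xrightarrow{\alpha}P'$ are the least relations such that: $\mathrm{div}\xrightarrow{\tau}\mathrm{div}$; $(a\to P)\xrightarrow{a}P$; $P\sqcap Q\xrightarrow{\tau}P$, $P\sqcap Q\xrightarrow{\tau}Q$; if $P\xrightarrow{a}P'$ then $P\Box Q\xrightarrow{a}P'$, $Q\Box P\xrightarrow{a}P'$, $P\rhd Q\xrightarrow{a}P'$; if $P\xrightarrow{\tau}P'$ then $P\Box Q\xrightarrow{\tau}P'\Box Q$, $Q\Box P\xrightarrow{\tau}Q\Box P'$, $P\rhd Q\xrightarrow{\tau}P'\rhd Q$; $P\rhd Q\xrightarrow{\tau}Q$; if $P\xrightarrow{\alpha}P'$ then $f(P)\xrightarrow{f(\alpha)}f(P')$;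 if $P\xrightarrow{\alpha}P'$, $\alpha\notin A$, then $P\|_AQ\xrightarrow{\alpha}P'\|_AQ$, $Q\|_AP\xrightarrow{\alpha}Q\|_AP'$, $P\setminus A\xrightarrow{\alpha}P'\setminus A$, $P\Theta_AQ\xrightarrow{\alpha}P'\Theta_AQ$; if $P\xrightarrow{a}P'$, $Q\xrightarrow{a}Q'$, $a\in A$, then $P\|_AQ\xrightarrow{a}P'\|_AQ'$; if $P\xrightarrow{a}P'$, $a\in A$, then $P\setminus A\xrightarrow{\tau}P'\setminus A$ and $P\Theta_AQ\xrightarrow{a}Q$; if $P\xrightarrow{\alpha}P'$ then $P\triangle Q\xrightarrow{\alpha}P'\triangle Q$; if $Q\xrightarrow{\tau}Q'$ then $P\triangle Q\xrightarrow{\tau}P\triangle Q'$; if $Q\xrightarrow{a}Q'$ then $P\triangle Q\xrightarrow{a}Q'$; $\mu X.P\xrightarrow{\tau}P[\mu X.P/X]$. Write $P\Rightarrow Q$ if $P=P_0\xrightarrow{\tau}\cdots\xrightarrow{\tau}P_n=Q$ ($n\ge 0$); $P\overset{\alpha}{\Rightarrow}Q$ if $P\Rightarrow P'\xrightarrow{\alpha}Q'\Rightarrow Q$; $P\overset{\hat\alpha}{\Rightarrow}Q$ means $P\overset{\alpha}{\Rightarrow}Q$ if $\alpha\in\Sigma$ and $P\Rightarrow Q$ if $\alpha=\tau$. $P{\Uparrow}$ ($P$ diverges) if there are $P_0,P_1,\dots$ with $P\Rightarrow P_0\xrightarrow{\tau}P_1\xrightarrow{\tau}\cdots$. A coupled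 simulation is a relation $\mathcal R$ on CSP processes such that (i) if $P\mathcal RQ$ and $P\xrightarrow{\alpha}P'$ then $Q\overset{\hat\alpha}{\Rightarrow}Q'$ with $P'\mathcal RQ'$ for some $Q'$, and (ii) if $P\mathcal RQ$ then $Q\Rightarrow Q'$ with $Q'\mathcal RP$ for some $Q'$; it is divergence-preserving if $P\mathcal RQ$ and $P{\Uparrow}$ imply $Q{\Uparrow}$. $P\sqsupseteq_{CS}^\Delta Q$ (also written $Q\sqsubseteq_{CS}^\Delta P$) iff $P\mathcal RQ$ for some divergence-preserving coupled simulation $\mathcal R$; $P\equiv_{CS}^\Delta Q$ iff $P\sqsupseteq_{CS}^\Delta Q$ and $Q\sqsupseteq_{CS}^\Delta P$. -}

module Defs where

open import Level using (Level; 0ℓ) renaming (suc to lsuc)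
open import Data.Nat using (ℕ; suc; _≟_)
open import Data.List using (List; []; _∷_; _++_; filter)
open import Data.Product using (Σ; ∃; ∃-syntax; _×_; _,_; proj₁)
open import Data.Unit using (⊤)
open import Relation.Nullary using (¬_; yes; no)
open import Relation.Nullary.Decidable using (¬?)
open import Relation.Unary using (Pred)
open import Relation.Binary.PropositionalEquality using (_≡_)
open import Relation.Binary.Construct.Closure.ReflexiveTransitive using (Star)

-- Process identifiers are natural numbers; C is the set Σ of communications.
Ident : Set
Ident = ℕ

data Expr (C : Set) : Set₁ where
  STOP  : Expr C
  div   : Expr C
  _⟶_   : C → Expr C → Expr C
  _⊓_   : Expr C → Expr C → Expr C
  _□_   : Expr C → Expr C → Expr C
  _▷_   : Expr C → Expr C → Expr C
  par   : Expr C → Pred C 0ℓ → Expr C → Expr C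
  hide  : Expr C → Pred C 0ℓ → Expr C
  ren   : (C → C) → Expr C → Expr C
  _△_   : Expr C → Expr C → Expr C
  throw : Expr C → Pred C 0ℓ → Expr C → Expr C
  var   : Ident → Expr C
  μ     : Ident → Expr C → Expr C

fv : ∀ {C} → Expr C → List Ident
fv STOP = []
fv div = []
fv (a ⟶ P) = fv P
fv (P ⊓ Q) = fv P ++ fv Q
fv (P □ Q) = fv P ++ fv Q
fv (P ▷ Q) = fv P ++ fv Q
fv (par P A Q) = fv P ++ fv Q
fv (hide P A) = fv P
fv (ren f P) = fv P
fv (P △ Q) = fv P ++ fv Q
fv (throw P A Q) = fv P ++ fv Q
fv (var X) = X ∷ []
fv (μ X P) = filter (λ Y → ¬? (Y ≟ X)) (fv P)

Closed : ∀ {C} → Expr C → Set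
Closed P = fv P ≡ []

-- substitution P[R/X] (R will always be closed, so no capture can occur)
_[_/_] : ∀ {C} → Expr C → Expr C → Ident → Expr C
STOP [ R / X ] = STOP
div [ R / X ] = div
(a ⟶ P) [ R / X ] = a ⟶ (P [ R / X ])
(P ⊓ Q) [ R / X ] = (P [ R / X ]) ⊓ (Q [ R / X ])
(P □ Q) [ R / X ] = (P [ R / X ]) □ (Q [ R / X ])
(P ▷ Q) [ R / X ] = (P [ R / X ]) ▷ (Q [ R / X ])
par P A Q [ R / X ] = par (P [ R / X ]) A (Q [ R / X ])
hide P A [ R / X ] = hide (P [ R / X ]) A
ren f P [ R / X ] = ren f (P [ R / X ])
(P △ Q) [ R / X ] = (P [ R / X ]) △ (Q [ R / X ])
throw P A Q [ R / X ] = throw (P [ R / X ]) A (Q [ R / X ])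
var Y [ R / X ] with X ≟ Y
... | yes _ = R
... | no _ = var Y
μ Y P [ R / X ] with X ≟ Y
... | yes _ = μ Y P
... | no _ = μ Y (P [ R / X ])

data Act (C : Set) : Set where
  τ   : Act C
  vis : C → Act C

mapAct : ∀ {C} → (C → C) → Act C → Act C
mapAct f τ = τ
mapAct f (vis a) = vis (f a)

_∉ᵃ_ : ∀ {C} → Act C → Pred C 0ℓ → Set
τ ∉ᵃ A = ⊤
vis a ∉ᵃ A = ¬ A a

infix 4 _—[_]→_
data _—[_]→_ {C : Set} : Expr C → Act C → Expr C → Set₁ where
  div-τ   : div —[ τ ]→ div
  prefix  : ∀ {a P} → (a ⟶ P) —[ vis a ]→ P
  ⊓-l     : ∀ {P Q} → (P ⊓ Q) —[ τ ]→ P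
  ⊓-r     : ∀ {P Q} → (P ⊓ Q) —[ τ ]→ Q
  □-l     : ∀ {a P P' Q} → P —[ vis a ]→ P' → (P □ Q) —[ vis a ]→ P'
  □-r     : ∀ {a P P' Q} → P —[ vis a ]→ P' → (Q □ P) —[ vis a ]→ P'
  ▷-vis   : ∀ {a P P' Q} → P —[ vis a ]→ P' → (P ▷ Q) —[ vis a ]→ P'
  □-τl    : ∀ {P P' Q} → P —[ τ ]→ P' → (P □ Q) —[ τ ]→ (P' □ Q)
  □-τr    : ∀ {P P' Q} → P —[ τ ]→ P' → (Q □ P) —[ τ ]→ (Q □ P')
  ▷-τ     : ∀ {P P' Q} → P —[ τ ]→ P' → (P ▷ Q) —[ τ ]→ (P' ▷ Q)
  ▷-time  : ∀ {P Q} → (P ▷ Q) —[ τ ]→ Q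
  ren-α   : ∀ {f α P P'} → P —[ α ]→ P' → ren f P —[ mapAct f α ]→ ren f P'
  par-l   : ∀ {α A P P' Q} → P —[ α ]→ P' → α ∉ᵃ A → par P A Q —[ α ]→ par P' A Q
  par-r   : ∀ {α A P P' Q} → P —[ α ]→ P' → α ∉ᵃ A → par Q A P —[ α ]→ par Q A P'
  hide-α  : ∀ {α A P P'} → P —[ α ]→ P' → α ∉ᵃ A → hide P A —[ α ]→ hide P' A
  throw-α : ∀ {α A P P' Q} → P —[ α ]→ P' → α ∉ᵃ A → throw P A Q —[ α ]→ throw P' A Q
  par-sync : ∀ {a A P P' Q Q'} → P —[ vis a ]→ P' → Q —[ vis a ]→ Q' → A a →
             par P A Q —[ vis a ]→ par P' A Q'
  hide-τ  : ∀ {a A P P'} → P —[ vis a ]→ P' → A a → hide P A —[ τ ]→ hide P' A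
  throw-a : ∀ {a A P P' Q} → P —[ vis a ]→ P' → A a → throw P A Q —[ vis a ]→ Q
  △-l     : ∀ {α P P' Q} → P —[ α ]→ P' → (P △ Q) —[ α ]→ (P' △ Q)
  △-τr    : ∀ {P Q Q'} → Q —[ τ ]→ Q' → (P △ Q) —[ τ ]→ (P △ Q')
  △-vis   : ∀ {a P Q Q'} → Q —[ vis a ]→ Q' → (P △ Q) —[ vis a ]→ Q'
  unfold  : ∀ {X P} → μ X P —[ τ ]→ (P [ μ X P / X ])

Proc : Set → Set₁
Proc C = Σ (Expr C) Closed

infix 4 _—→_ _⇒_ _=[_]⇒_ _=[_]⇒̂_
_—→_ : ∀ {C} → Proc C → Proc C → Set₁
P —→ Q = proj₁ P —[ τ ]→ proj₁ Q

_⇒_ : ∀ {C} → Proc C → Proc C → Set₁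
_⇒_ = Star _—→_

_=[_]⇒_ : ∀ {C} → Proc C → Act C → Proc C → Set₁
P =[ α ]⇒ Q = ∃[ P' ] ∃[ Q' ] (P ⇒ P' × proj₁ P' —[ α ]→ proj₁ Q' × Q' ⇒ Q)

_=[_]⇒̂_ : ∀ {C} → Proc C → Act C → Proc C → Set₁
P =[ τ ]⇒̂ Q = P ⇒ Q
P =[ vis a ]⇒̂ Q = P =[ vis a ]⇒ Q

_⇑ : ∀ {C} → Proc C → Set₁
P ⇑ = Σ (ℕ → Proc _) λ s → (P ⇒ s 0 × (∀ n → s n —→ s (suc n)))

Rel : Set → Set₂
Rel C = Proc C → Proc C → Set₁

record IsDivPresCoupledSim {C : Set} (R : Rel C) : Set₁ where
  field
    sim     : ∀ {P Q P' α} → R P Q → proj₁ P —[ α ]→ proj₁ P' →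
              ∃[ Q' ] (Q =[ α ]⇒̂ Q' × R P' Q')
    coupled : ∀ {P Q} → R P Q → ∃[ Q' ] (Q ⇒ Q' × R Q' P)
    divpres : ∀ {P Q} → R P Q → P ⇑ → Q ⇑

_⊒CSΔ_ : ∀ {C} → Proc C → Proc C → Set₂
P ⊒CSΔ Q = ∃[ R ] (IsDivPresCoupledSim R × R P Q)

_⊑CSΔ_ : ∀ {C} → Proc C → Proc C → Set₂
Q ⊑CSΔ P = P ⊒CSΔ Q

module Submission where

open import Defs
open import Data.Product using (_,_; proj₁)
open import Relation.Binary.Construct.Closure.ReflexiveTransitive using (ε; _◅_; _◅◅_)

infix 4 _⇐_

_⇐_ : ∀ {C} → Rel C
P ⇐ Q = Q ⇒ P

⇒-◅-=⇒̂ : ∀ {C} {P Q Q' : Proc C} {α} →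
         P ⇒ Q → proj₁ Q —[ α ]→ proj₁ Q' → P =[ α ]⇒̂ Q'
⇒-◅-=⇒̂ {α = τ} P⇒Q Q→Q' = P⇒Q ◅◅ Q→Q' ◅ ε
⇒-◅-=⇒̂ {Q = Q} {Q'} {vis a} P⇒Q Q→Q' = Q , Q' , P⇒Q , Q→Q' , ε

⇒-⇑ : ∀ {C} {P Q : Proc C} → P ⇒ Q → Q ⇑ → P ⇑
⇒-⇑ P⇒Q (s , Q⇒s₀ , s-steps) = s , P⇒Q ◅◅ Q⇒s₀ , s-steps

-- Q can always replay the τ-path to P, after which both sides coincide.
⇐-isDivPresCoupledSim : ∀ {C} → IsDivPresCoupledSim {C} _⇐_
⇐-isDivPresCoupledSim = record
  { sim     = λ {_} {_} {P'} Q⇒P P→P' → P' , ⇒-◅-=⇒̂ Q⇒P P→P' , ε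
  ; coupled = λ {P} Q⇒P → P , Q⇒P , ε
  ; divpres = ⇒-⇑
  }

proposition2 : {C : Set} (P Q : Proc C) → P ⇒ Q → P ⊑CSΔ Q
proposition2 P Q P⇒Q = _⇐_ , ⇐-isDivPresCoupledSim , P⇒Q
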